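{- There exist a set $X$, a numbered subbasis $(\mathfrak{B},\beta)$ for $X$ and a subset $A\subseteq X$ such that, for the restricted numbered subbasis $(\mathfrak{A},\alpha)$ of $A$, the multi-representations $\rho_{\alpha}^{\min}$ and $(\rho_{\beta}^{\min})_{\vert A}$ are not equivalent.
   Context: A multi-representation of a set $Y$ is a partial multi-valued map $\rho:\subseteq\mathbb{N}^{\mathbb{N}}\rightrightarrows Y$ (an assignment $f\mapsto\rho(f)\subseteq Y$, $\text{dom}(\rho)=\{f:\rho(f)\neq\emptyset\}$) with every point in some $\rho(f)$. $\rho_1\le\rho_2$ means there is a Type-2 computable partial $F:\subseteq\mathbb{N}^{\mathbb{N}}\to\mathbb{N}^{\mathbb{N}}$ defined on $\text{dom}(\rho_1)$ with $\rho_1(f)\subseteq\rho_2(F(f))$; $\rho_1\equiv\rho_2$ means both $\rho_1\le\rho_2$ and $\rho_2\le\rho_1$. Restriction of a multi-representation $\rho$ of $X$ to $A$: $\text{dom}(\rho_{\vert A})=\{f\in\text{dom}(\rho):\rho(f)\cap A\neq\emptyset\}$, $\rho_{\vert A}(f)=\rho(f)\cap A$. A numbered subbasis for $X$ is a countable $\mathfrak{B}\subseteq\mathcal{P}(X)$ with a partial surjection $\beta:\subseteq\mathbb{N}\to\mathfrak{B}$. $x\in\rho_\beta^{\min}(f)$ iff every $f(n)\in\text{dom}(\beta)$ with $x\in\beta(f(n))$, and for every $B\in\mathfrak{B}$ with $x\in B$ there exist $n_1,\dots,n_k$ with $\beta(f(n_1))\cap\dots\cap\beta(f(n_k))\subseteq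 B$. Restricted subbasis of $A$: $\text{dom}(\alpha)=\text{dom}(\beta)$, $\alpha(n)=A\cap\beta(n)$, $\mathfrak{A}=\alpha(\text{dom}\,\alpha)$; $\rho_\alpha^{\min}$ is defined on $A$ analogously with $\alpha,\mathfrak{A}$. -}

module Defs where

open import Data.Nat using (ℕ; zero; suc; _<_)
open import Data.Fin using (Fin)
open import Data.Vec using (Vec; []; _∷_; lookup)
open import Data.List using (List)
open import Data.List.Relation.Unary.All using (All)
open import Data.Maybe using (Maybe; just; nothing; map)
open import Data.Product using (Σ; ∃; _×_; proj₁)
open import Data.Empty using (⊥)

Baire : Set
Baire = ℕ → ℕ

-- Codes for partial recursive functions of arity n relative to an oracle.
data Code : ℕ → Set where
  Z    : ∀ {n} → Code n
  S    : Code 1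
  P    : ∀ {n} → Fin n → Code n
  O    : Code 1                                       -- oracle query
  comp : ∀ {m n} → Code m → Vec (Code n) m → Code n
  prec : ∀ {n} → Code n → Code (suc (suc n)) → Code (suc n)
  mu   : ∀ {n} → Code (suc n) → Code n

-- Big-step semantics with oracle f: Eval f e xs y  means  e^f(xs) halts with y.
mutual
  data Eval (f : Baire) : ∀ {n} → Code n → Vec ℕ n → ℕ → Set where
    evZ    : ∀ {n} {xs : Vec ℕ n} → Eval f Z xs 0
    evS    : ∀ {x} → Eval f S (x ∷ []) (suc x)
    evP    : ∀ {n} {i : Fin n} {xs} → Eval f (P i) xs (lookup xs i)
    evO    : ∀ {x} → Eval f O (x ∷ []) (f x)
    evComp : ∀ {m n} {g : Code m} {hs : Vec (Code n) m} {xs ys y} →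
             EvalVec f hs xs ys → Eval f g ys y → Eval f (comp g hs) xs y
    evPrec0 : ∀ {n} {g : Code n} {h} {xs y} →
             Eval f g xs y → Eval f (prec g h) (0 ∷ xs) y
    evPrecS : ∀ {n} {g : Code n} {h} {k xs r y} →
             Eval f (prec g h) (k ∷ xs) r → Eval f h (k ∷ r ∷ xs) y →
             Eval f (prec g h) (suc k ∷ xs) y
    evMu   : ∀ {n} {e : Code (suc n)} {xs y} →
             Eval f e (y ∷ xs) 0 →
             (∀ z → z < y → ∃ λ w → Eval f e (z ∷ xs) (suc w)) →
             Eval f (mu e) xs y

  data EvalVec (f : Baire) {n : ℕ} : ∀ {m} → Vec (Code n) m → Vec ℕ n → Vec ℕ m → Set where
    [] : ∀ {xs} → EvalVec f [] xs []
    _∷_ : ∀ {m} {h : Code n} {hs : Vec (Code n) m} {xs y ys} →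
          Eval f h xs y → EvalVec f hs xs ys → EvalVec f (h ∷ hs) xs (y ∷ ys)

-- ρ f y  means  y ∈ ρ(f);  dom ρ = { f | ∃ y. ρ f y }.
MultiRep : Set → Set₁
MultiRep Y = Baire → Y → Set

-- ρ₁ ≤ ρ₂ : some Type-2 computable F (given by an oracle code e, F(f)(n) = e^f(n)),
-- defined on dom ρ₁, with ρ₁(f) ⊆ ρ₂(F(f)).
_≤ʳ_ : ∀ {Y} → MultiRep Y → MultiRep Y → Set
_≤ʳ_ {Y} ρ₁ ρ₂ = Σ (Code 1) λ e → ∀ (f : Baire) → (∃ λ (y : Y) → ρ₁ f y) →
  Σ Baire λ g → (∀ n → Eval f e (n ∷ []) (g n)) × (∀ y → ρ₁ f y → ρ₂ g y)

_≡ʳ_ : ∀ {Y} → MultiRep Y → MultiRep Y → Set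
ρ₁ ≡ʳ ρ₂ = (ρ₁ ≤ʳ ρ₂) × (ρ₂ ≤ʳ ρ₁)

-- Restriction of a multi-representation of X to A ⊆ X (points of A as Σ X A).
restrict : ∀ {X} (A : X → Set) → MultiRep X → MultiRep (Σ X A)
restrict A ρ f a = ρ f (proj₁ a)

-- β : ⊆ ℕ → 𝔅 as a partial map; 𝔅 is its image, dom β = { n | β n ≠ nothing }.
NumberedSubbasis : Set → Set₁
NumberedSubbasis X = ℕ → Maybe (X → Set)

_∈β_ : ∀ {X : Set} → X → Maybe (X → Set) → Set
x ∈β nothing = ⊥
x ∈β just B  = B x

ρmin : ∀ {X} → NumberedSubbasis X → MultiRep X
ρmin {X} β f x =
  (∀ n → x ∈β β (f n)) ×
  (∀ m → x ∈β β m →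
     Σ (List ℕ) λ ns → ∀ (y : X) → All (λ i → y ∈β β (f i)) ns → y ∈β β m)

-- Restricted numbered subbasis of A: α(n) = A ∩ β(n), as subsets of A.
restrictSB : ∀ {X} (A : X → Set) → NumberedSubbasis X → NumberedSubbasis (Σ X A)
restrictSB A β n = map (λ B a → B (proj₁ a)) (β n)

-- Take X = Maybe ℕ, A = {nothing} and basic sets
-- B_m = {nothing | m ∈ D} ∪ {just k | k ≠ m}.  Since just m lies in every B_{m'}
-- except B_m, a finite intersection of subbasic sets is contained in B_m only if it
-- uses B_m itself; hence a ρ_β^min-name of nothing enumerates exactly D.  On A, on the other
-- hand, every α-set containing nothing is all of A, so the constant sequence 0 is a
-- ρ_α^min-name of nothing provided 0 ∈ D.  A reduction ρ_α^min ≤ ρ_β^min|A would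
-- therefore turn this name into a computable enumeration of D, and D is chosen by
-- diagonalising against all such enumerations: m ∈ D iff m = 0 or m is the Gödel
-- number of a program that never outputs m.
{-# OPTIONS --safe #-}
module Submission where

open import Defs
open import Data.Fin using (toℕ)
open import Data.Fin.Properties using (toℕ-injective)
import Data.List as List
open import Data.List.Relation.Unary.All.Properties using (¬All⇒Any¬)
open import Data.List.Relation.Unary.Any using (satisfied)
open import Data.Maybe using (Maybe; just; nothing)
open import Data.Nat using (ℕ; zero; suc; _≟_; <-cmp)
open import Data.Nat.Binary using (ℕᵇ; 2[1+_]; 1+[2_]) renaming (zero to zeroᵇ; toℕ to toℕᵇ)
open import Data.Nat.Binary.Properties using () renaming (toℕ-injective to toℕᵇ-injective)
open import Data.Nat.Properties using (suc-injective; 0≢1+n)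
open import Data.Product using (Σ; ∃; _×_; _,_; proj₁; proj₂)
open import Data.Sum using (_⊎_; inj₁; inj₂)
open import Data.Vec using (Vec; []; _∷_)
open import Function.Bundles using (_⇔_; mk⇔; Equivalence)
open import Function.Base using (_∘_)
open import Function.Definitions using (Injective)
open import Relation.Binary.Definitions using (tri<; tri≈; tri>)
open import Relation.Binary.PropositionalEquality using (_≡_; _≢_; refl; sym; cong₂)
open import Relation.Nullary using (¬_; ¬?)
open import Relation.Nullary.Decidable using (decidable-stable)
open import Relation.Nullary.Negation using (contradiction)

private
  variable
    n : ℕ

unary : ℕ → ℕᵇ → ℕᵇ
unary zero    r = 1+[2 r ]
unary (suc k) r = 2[1+ unary k r ]

unary-injective : ∀ k k' {r r'} → unary k r ≡ unary k' r' → k ≡ k' × r ≡ r'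
unary-injective zero    zero     refl = refl , refl
unary-injective (suc k) (suc k') eq   with unary-injective k k' (strip eq)
  where
  strip : ∀ {x y} → 2[1+ x ] ≡ 2[1+ y ] → x ≡ y
  strip refl = refl
... | refl , r≡r' = refl , r≡r'

tag : Code n → ℕ
tag Z          = 0
tag S          = 1
tag (P _)      = 2
tag O          = 3
tag (comp _ _) = 4
tag (prec _ _) = 5
tag (mu _)     = 6

mutual
  encode : Code n → ℕᵇ → ℕᵇ
  encode e r = unary (tag e) (fields e r)

  fields : Code n → ℕᵇ → ℕᵇ
  fields Z                r = r
  fields S                r = r
  fields (P i)            r = unary (toℕ i) r
  fields O                r = r
  fields (comp {m} g hs)  r = unary m (encode g (encodeAll hs r))
  fields (prec g h)       r = encode g (encode h r)
  fields (mu e)           r = encode e r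

  encodeAll : ∀ {k} → Vec (Code n) k → ℕᵇ → ℕᵇ
  encodeAll []       r = r
  encodeAll (h ∷ hs) r = encode h (encodeAll hs r)

mutual
  encode-injective : (e e' : Code n) {r r' : ℕᵇ} →
                     encode e r ≡ encode e' r' → e ≡ e' × r ≡ r'
  encode-injective e e' eq with unary-injective (tag e) (tag e') eq
  ... | tag≡ , fields≡ = fields-injective e e' tag≡ fields≡

  -- Mismatched constructors are excluded by the absurd equation on their tags.
  fields-injective : (e e' : Code n) {r r' : ℕᵇ} →
                     tag e ≡ tag e' → fields e r ≡ fields e' r' → e ≡ e' × r ≡ r'
  fields-injective Z Z refl eq = refl , eq
  fields-injective S S refl eq = refl , eq
  fields-injective (P i) (P i') refl eq with unary-injective (toℕ i) (toℕ i') eq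
  ... | i≡i' , r≡r' rewrite toℕ-injective i≡i' = refl , r≡r'
  fields-injective O O refl eq = refl , eq
  fields-injective (comp {m} g hs) (comp {m'} g' hs') refl eq
    with unary-injective m m' eq
  ... | refl , eq₁ with encode-injective g g' eq₁
  ... | refl , eq₂ with encodeAll-injective hs hs' eq₂
  ... | refl , r≡r' = refl , r≡r'
  fields-injective (prec g h) (prec g' h') refl eq with encode-injective g g' eq
  ... | refl , eq₁ with encode-injective h h' eq₁
  ... | refl , r≡r' = refl , r≡r'
  fields-injective (mu e) (mu e') refl eq with encode-injective e e' eq
  ... | refl , r≡r' = refl , r≡r'

  encodeAll-injective : ∀ {k} (hs hs' : Vec (Code n) k) {r r' : ℕᵇ} →
                        encodeAll hs r ≡ encodeAll hs' r' → hs ≡ hs' × r ≡ r'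
  encodeAll-injective []       []         eq = refl , eq
  encodeAll-injective (h ∷ hs) (h' ∷ hs') eq with encode-injective h h' eq
  ... | refl , eq₁ with encodeAll-injective hs hs' eq₁
  ... | refl , r≡r' = refl , r≡r'

-- Positive, so that putting 0 into the diagonal set does not interfere with the diagonalisation.
⌜_⌝ : Code n → ℕ
⌜ e ⌝ = suc (toℕᵇ (encode e zeroᵇ))

⌜⌝-injective : Injective _≡_ _≡_ (⌜_⌝ {n})
⌜⌝-injective {x = e} {e'} eq =
  proj₁ (encode-injective e e' (toℕᵇ-injective (suc-injective eq)))

mutual
  Eval-deterministic : ∀ {f} {e : Code n} {xs y y'} →
                       Eval f e xs y → Eval f e xs y' → y ≡ y'
  Eval-deterministic evZ evZ = refl
  Eval-deterministic evS evS = refl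
  Eval-deterministic evP evP = refl
  Eval-deterministic evO evO = refl
  Eval-deterministic (evComp hs g) (evComp hs' g')
    with EvalVec-deterministic hs hs'
  ... | refl = Eval-deterministic g g'
  Eval-deterministic (evPrec0 g) (evPrec0 g') = Eval-deterministic g g'
  Eval-deterministic (evPrecS rec h) (evPrecS rec' h')
    with Eval-deterministic rec rec'
  ... | refl = Eval-deterministic h h'
  Eval-deterministic (evMu {y = y} e0 below) (evMu {y = y'} e0' below')
    with <-cmp y y'
  ... | tri< y<y' _ _ = contradiction (Eval-deterministic e0 (proj₂ (below' y y<y'))) 0≢1+n
  ... | tri≈ _ y≡y' _ = y≡y'
  ... | tri> _ _ y'<y = contradiction (Eval-deterministic e0' (proj₂ (below y' y'<y))) 0≢1+n

  EvalVec-deterministic : ∀ {f k} {hs : Vec (Code n) k} {xs ys ys'} →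
                          EvalVec f hs xs ys → EvalVec f hs xs ys' → ys ≡ ys'
  EvalVec-deterministic []       []         = refl
  EvalVec-deterministic (h ∷ hs) (h' ∷ hs') =
    cong₂ _∷_ (Eval-deterministic h h') (EvalVec-deterministic hs hs')

Outputs : Baire → Code 1 → ℕ → Set
Outputs f e m = ∃ λ n → Eval f e (n ∷ []) m

Diagonal : Baire → ℕ → Set
Diagonal f m = m ≡ 0 ⊎ Σ (Code 1) λ e → ⌜ e ⌝ ≡ m × ¬ Outputs f e m

Diagonal⌜⌝⇔¬Outputs : ∀ f e → Diagonal f ⌜ e ⌝ ⇔ (¬ Outputs f e ⌜ e ⌝)
Diagonal⌜⌝⇔¬Outputs f e = mk⇔ to λ silent → inj₂ (e , refl , silent)
  where
  to : Diagonal f ⌜ e ⌝ → ¬ Outputs f e ⌜ e ⌝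
  to (inj₁ ())
  to (inj₂ (e' , ⌜e'⌝≡⌜e⌝ , silent)) with ⌜⌝-injective {x = e'} {y = e} ⌜e'⌝≡⌜e⌝
  ... | refl = silent

Outputs⇔range : ∀ {f e} {g : Baire} → (∀ n → Eval f e (n ∷ []) (g n)) →
                ∀ m → Outputs f e m ⇔ (∃ λ i → g i ≡ m)
Outputs⇔range e-computes-g m = mk⇔
  (λ (i , ev) → i , Eval-deterministic (e-computes-g i) ev)
  (λ { (i , refl) → i , e-computes-g i })

Diagonal-not-computable-range : ∀ f e (g : Baire) → (∀ n → Eval f e (n ∷ []) (g n)) →
                                ¬ (∀ m → Diagonal f m ⇔ (∃ λ i → g i ≡ m))
Diagonal-not-computable-range f e g e-computes-g range = not-diagonal diagonal
  where
  open Equivalence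
  diagonal→outputs : Diagonal f ⌜ e ⌝ → Outputs f e ⌜ e ⌝
  diagonal→outputs = from (Outputs⇔range e-computes-g ⌜ e ⌝) ∘ to (range ⌜ e ⌝)
  outputs→diagonal : Outputs f e ⌜ e ⌝ → Diagonal f ⌜ e ⌝
  outputs→diagonal = from (range ⌜ e ⌝) ∘ to (Outputs⇔range e-computes-g ⌜ e ⌝)
  not-diagonal : ¬ Diagonal f ⌜ e ⌝
  not-diagonal d = to (Diagonal⌜⌝⇔¬Outputs f e) d (diagonal→outputs d)
  diagonal : Diagonal f ⌜ e ⌝
  diagonal = from (Diagonal⌜⌝⇔¬Outputs f e) (not-diagonal ∘ outputs→diagonal)

zeros : Baire
zeros _ = 0

basicSet : ℕ → Maybe ℕ → Set
basicSet m nothing  = Diagonal zeros m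
basicSet m (just k) = k ≢ m

β : NumberedSubbasis (Maybe ℕ)
β m = just (basicSet m)

A : Maybe ℕ → Set
A x = x ≡ nothing

zeros-names-nothing : ρmin (restrictSB A β) zeros (nothing , refl)
zeros-names-nothing =
  (λ _ → inj₁ refl) , λ { _ in-set → List.[] , λ { (nothing , refl) _ → in-set } }

ρmin-name-range : ∀ {g} → ρmin β g nothing → ∀ m → Diagonal zeros m ⇔ (∃ λ i → g i ≡ m)
ρmin-name-range {g} (in-sets , covers) m = mk⇔ enumerated λ { (i , refl) → in-sets i }
  where
  enumerated : Diagonal zeros m → ∃ λ i → g i ≡ m
  enumerated d with covers m d
  ... | ns , ⊆Bₘ with satisfied (¬All⇒Any¬ (λ i → ¬? (m ≟ g i)) ns (λ all → ⊆Bₘ (just m) all refl))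
  ... | i , ¬m≢gi = i , sym (decidable-stable (m ≟ g i) ¬m≢gi)

ρmin-restrictSB≰restrict-ρmin : ¬ (ρmin (restrictSB A β) ≤ʳ restrict A (ρmin β))
ρmin-restrictSB≰restrict-ρmin (e , reduce)
  with reduce zeros ((nothing , refl) , zeros-names-nothing)
... | g , e-computes-g , preserves =
  Diagonal-not-computable-range zeros e g e-computes-g
    (ρmin-name-range (preserves (nothing , refl) zeros-names-nothing))

corollary4p5 : Σ Set λ X → Σ (NumberedSubbasis X) λ β → Σ (X → Set) λ A →
    ¬ (ρmin (restrictSB A β) ≡ʳ restrict A (ρmin β))
corollary4p5 = Maybe ℕ , β , A , ρmin-restrictSB≰restrict-ρmin ∘ proj₁
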